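{- Let $A_0,\dots,A_{n-1}$ be subalgebras of a Boolean algebra $B$. Then $(A_i)_{i<n}$ commutes in $B$ if and only if for all ultrafilters $U_i$ of $A_i$ ($i<n$) satisfying $U_i\cap A_j=U_j\cap A_i$ for all $i,j<n$, the set $\bigcup_{i<n}U_i$ extends to an ultrafilter of $B$.
   Context: Given subalgebras $A_0,\dots,A_{n-1}$ of $B$, let $P$ be the quotient of the free product $\bigoplus_{i<n}A_i$ (cofactor maps $\iota_i$) by the ideal generated by all $\iota_i(z)\wedge\iota_j(-z)$ with $z\in A_i\cap A_j$; $(A_i)_{i<n}$ commutes in $B$ if the unique homomorphism $P\to B$ extending the inclusions $A_i\to B$ is injective. -}

module Defs where

open import Level using (Level; _⊔_; suc)
open import Data.Nat using (ℕ)
open import Data.Fin using (Fin)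
open import Data.Product using (Σ; ∃; _×_; _,_)
open import Data.Sum using (_⊎_)
open import Data.List using (List; []; _∷_)
open import Relation.Nullary using () renaming (¬_ to Not)
open import Relation.Unary using (Pred; _⊆_)
import Relation.Unary as RU
open import Function.Bundles using (_⇔_)
open import Algebra.Lattice.Bundles using (BooleanAlgebra)

module _ {c ℓ : Level} (B : BooleanAlgebra c ℓ) where
  open BooleanAlgebra B

  _≤B_ : Carrier → Carrier → Set ℓ
  x ≤B y = (x ∧ y) ≈ x

  record IsSubalgebra {p : Level} (A : Pred Carrier p) : Set (c ⊔ ℓ ⊔ p) where
    field
      resp : ∀ {x y} → x ≈ y → A x → A y
      ⊤∈   : A ⊤
      ⊥∈   : A ⊥
      ∧∈   : ∀ {x y} → A x → A y → A (x ∧ y)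
      ∨∈   : ∀ {x y} → A x → A y → A (x ∨ y)
      ¬∈   : ∀ {x} → A x → A (¬ x)

  record IsUltrafilter {a u : Level} (A : Pred Carrier a) (U : Pred Carrier u)
         : Set (c ⊔ ℓ ⊔ a ⊔ u) where
    field
      sub    : U ⊆ A
      ⊤∈     : U ⊤
      ⊥∉     : Not (U ⊥)
      ∧∈     : ∀ {x y} → U x → U y → U (x ∧ y)
      up     : ∀ {x y} → U x → A y → x ≤B y → U y
      ultra  : ∀ {x} → A x → U x ⊎ U (¬ x)

  record IsProperFilter {u : Level} (F : Pred Carrier u) : Set (c ⊔ ℓ ⊔ u) where
    field
      ⊤∈  : F ⊤
      ⊥∉  : Not (F ⊥)
      ∧∈  : ∀ {x y} → F x → F y → F (x ∧ y)
      up  : ∀ {x y} → F x → x ≤B y → F y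

BPI : (c ℓ u : Level) → Set (suc (c ⊔ ℓ ⊔ u))
BPI c ℓ u = (B : BooleanAlgebra c ℓ) (F : Pred (BooleanAlgebra.Carrier B) u) →
  IsProperFilter B F →
  Σ (Pred (BooleanAlgebra.Carrier B) u) λ V → IsUltrafilter B RU.U V × F ⊆ V

module _ {c ℓ p : Level} (B : BooleanAlgebra c ℓ) (n : ℕ)
         (A : Fin n → Pred (BooleanAlgebra.Carrier B) p) where
  open BooleanAlgebra B using (Carrier; _≈_; _∨_; _∧_; ¬_; ⊤; ⊥)

  Gen : Set (c ⊔ p)
  Gen = Σ (Fin n) λ i → Σ Carrier (A i)

  data Tm : Set (c ⊔ p) where
    ι      : (i : Fin n) (a : Carrier) → A i a → Tm
    _∨ᵗ_   : Tm → Tm → Tm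
    _∧ᵗ_   : Tm → Tm → Tm
    ¬ᵗ_    : Tm → Tm
    ⊤ᵗ ⊥ᵗ  : Tm

  -- Equality in the free product: the congruence generated by the
  -- Boolean algebra axioms (as in stdlib's IsBooleanAlgebra) together
  -- with the requirement that each cofactor map ι_i : A_i → ⊕ A_i is a
  -- Boolean homomorphism (respecting ≈ of B).
  infix 4 _≈F_
  data _≈F_ : Tm → Tm → Set (c ⊔ ℓ ⊔ p) where
    reflF   : ∀ {s} → s ≈F s
    symF    : ∀ {s t} → s ≈F t → t ≈F s
    transF  : ∀ {s t u} → s ≈F t → t ≈F u → s ≈F u
    ∨-cong  : ∀ {s s' t t'} → s ≈F s' → t ≈F t' → (s ∨ᵗ t) ≈F (s' ∨ᵗ t')
    ∧-cong  : ∀ {s s' t t'} → s ≈F s' → t ≈F t' → (s ∧ᵗ t) ≈F (s' ∧ᵗ t')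
    ¬-cong  : ∀ {s s'} → s ≈F s' → (¬ᵗ s) ≈F (¬ᵗ s')
    ∨-comm  : ∀ s t → (s ∨ᵗ t) ≈F (t ∨ᵗ s)
    ∧-comm  : ∀ s t → (s ∧ᵗ t) ≈F (t ∧ᵗ s)
    ∨-assoc : ∀ s t u → ((s ∨ᵗ t) ∨ᵗ u) ≈F (s ∨ᵗ (t ∨ᵗ u))
    ∧-assoc : ∀ s t u → ((s ∧ᵗ t) ∧ᵗ u) ≈F (s ∧ᵗ (t ∧ᵗ u))
    ∨-absorbs-∧ : ∀ s t → (s ∨ᵗ (s ∧ᵗ t)) ≈F s
    ∧-absorbs-∨ : ∀ s t → (s ∧ᵗ (s ∨ᵗ t)) ≈F s
    ∨-distrib-∧ : ∀ s t u → (s ∨ᵗ (t ∧ᵗ u)) ≈F ((s ∨ᵗ t) ∧ᵗ (s ∨ᵗ u))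
    ∧-distrib-∨ : ∀ s t u → (s ∧ᵗ (t ∨ᵗ u)) ≈F ((s ∧ᵗ t) ∨ᵗ (s ∧ᵗ u))
    ∨-complement : ∀ s → (s ∨ᵗ (¬ᵗ s)) ≈F ⊤ᵗ
    ∧-complement : ∀ s → (s ∧ᵗ (¬ᵗ s)) ≈F ⊥ᵗ
    ι-cong : ∀ i {a b} (pa : A i a) (pb : A i b) → a ≈ b → ι i a pa ≈F ι i b pb
    ι-∨ : ∀ i {a b} (pa : A i a) (pb : A i b) (pab : A i (a ∨ b)) →
          ι i (a ∨ b) pab ≈F (ι i a pa ∨ᵗ ι i b pb)
    ι-∧ : ∀ i {a b} (pa : A i a) (pb : A i b) (pab : A i (a ∧ b)) →
          ι i (a ∧ b) pab ≈F (ι i a pa ∧ᵗ ι i b pb)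
    ι-¬ : ∀ i {a} (pa : A i a) (pna : A i (¬ a)) → ι i (¬ a) pna ≈F (¬ᵗ ι i a pa)
    ι-⊤ : ∀ i (p⊤ : A i ⊤) → ι i ⊤ p⊤ ≈F ⊤ᵗ
    ι-⊥ : ∀ i (p⊥ : A i ⊥) → ι i ⊥ p⊥ ≈F ⊥ᵗ

  _≤F_ : Tm → Tm → Set (c ⊔ ℓ ⊔ p)
  s ≤F t = (s ∧ᵗ t) ≈F s

  record IdealGen : Set (c ⊔ p) where
    constructor idealGen
    field
      i j : Fin n
      z   : Carrier
      zi  : A i z
      zj  : A j z
      nzj : A j (¬ z)

  genTm : IdealGen → Tm
  genTm (idealGen i j z zi zj nzj) = ι i z zi ∧ᵗ ι j (¬ z) nzj

  ⋁ : List IdealGen → Tm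
  ⋁ []       = ⊥ᵗ
  ⋁ (g ∷ gs) = genTm g ∨ᵗ ⋁ gs

  InIdeal : Tm → Set (c ⊔ ℓ ⊔ p)
  InIdeal s = Σ (List IdealGen) λ gs → s ≤F ⋁ gs

  _Δ_ : Tm → Tm → Tm
  s Δ t = (s ∧ᵗ (¬ᵗ t)) ∨ᵗ ((¬ᵗ s) ∧ᵗ t)

  _≈P_ : Tm → Tm → Set (c ⊔ ℓ ⊔ p)
  s ≈P t = InIdeal (s Δ t)

  eval : Tm → Carrier
  eval (ι i a _) = a
  eval (s ∨ᵗ t)  = eval s ∨ eval t
  eval (s ∧ᵗ t)  = eval s ∧ eval t
  eval (¬ᵗ s)    = ¬ eval s
  eval ⊤ᵗ        = ⊤
  eval ⊥ᵗ        = ⊥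

  Commutes : Set (c ⊔ ℓ ⊔ p)
  Commutes = ∀ s t → eval s ≈ eval t → s ≈P t

  UltrafilterExtension : Set (c ⊔ ℓ ⊔ Level.suc p)
  UltrafilterExtension =
    (U : Fin n → Pred Carrier p) →
    (∀ i → IsUltrafilter B (A i) (U i)) →
    (∀ i j x → (U i x × A j x) ⇔ (U j x × A i x)) →
    Σ (Pred Carrier p) λ V →
      IsUltrafilter B RU.U V × (∀ i {x} → U i x → V x)

-- (⇒) Compatible ultrafilters U_i define a two-valued homomorphism χ on the free
-- product that kills the ideal, so χ factors through P. If P → B is injective,
-- no element of the image of χ⁻¹(1) in B is ⊥; the filter it generates contains
-- every U_i, and the prime ideal theorem extends it to an ultrafilter.
-- (⇐) If s, t have the same value in B but s Δ t is not in the ideal, extend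
-- {s Δ t} ∪ {¬ g | g a generator of the ideal} to an ultrafilter W of the free
-- product. Its preimages under the cofactor maps are compatible ultrafilters, so
-- their union lies in an ultrafilter V of B; by induction on terms W s ⇔ V (eval s),
-- which puts eval (s Δ t) ≈ ⊥ into V.
module Submission where

open import Defs
open import Level using (Level; _⊔_; Lift; lift; lower)
open import Data.Nat using (ℕ)
open import Data.Fin using (Fin)
open import Data.Bool using (Bool; true; false; not) renaming (_∧_ to _&&_; _∨_ to _||_)
import Data.Bool.Properties as Bool
open import Data.List using (List; []; _∷_; _++_)
open import Data.Product using (Σ; _×_; _,_; proj₁; proj₂)
open import Data.Sum as Sum using (_⊎_; inj₁; inj₂)
open import Data.Unit using (tt)
open import Data.Empty using (⊥-elim)
open import Data.Product.Function.NonDependent.Propositional using (_×-⇔_)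
open import Data.Sum.Function.Propositional using (_⊎-⇔_)
open import Relation.Nullary using (yes; no; does; _×-dec_; _⊎-dec_; ¬?) renaming (¬_ to Not)
open import Relation.Nullary.Decidable using (True; toWitness; fromWitness; dec-true; dec-false; does-⇔)
open import Relation.Unary using (Pred; _⊆_)
import Relation.Unary as RU
open import Relation.Binary.PropositionalEquality using (_≡_; refl; cong; cong₂; module ≡-Reasoning)
import Relation.Binary.PropositionalEquality as ≡
open import Function.Bundles using (_⇔_; mk⇔; Equivalence)
open import Function.Construct.Composition using (_⇔-∘_)
open import Function.Construct.Symmetry using (⇔-sym)
open import Function.Related.TypeIsomorphisms using (¬-cong-⇔)
open import Axiom.ExcludedMiddle using (ExcludedMiddle)
open import Algebra.Lattice.Bundles using (BooleanAlgebra)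
import Relation.Binary.Lattice.Bundles as OrderTheoretic
import Relation.Binary.Lattice.Properties.MeetSemilattice as MeetSemilatticeProperties
import Relation.Binary.Lattice.Properties.JoinSemilattice as JoinSemilatticeProperties

-- The library's order is x ≈ x ∧ y, while filters are stated with _≤B_, i.e. x ∧ y ≈ x.
module BooleanOrder {c ℓ : Level} (X : BooleanAlgebra c ℓ) where
  open BooleanAlgebra X hiding (∨-cong; ∧-comm; ¬-cong)
  private module X = BooleanAlgebra X
  open import Algebra.Lattice.Properties.BooleanAlgebra X
    using (∧-identityʳ; ∧-zeroˡ; ∧-zeroʳ; ∨-identityˡ; ∨-identityʳ; deMorgan₂)
  open import Algebra.Lattice.Properties.Lattice lattice using (∨-∧-orderTheoreticLattice)
  open import Relation.Binary.Reasoning.Setoid setoid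

  open OrderTheoretic.Lattice ∨-∧-orderTheoreticLattice public
    using (_≤_; x∧y≤x; x∧y≤y; ∧-greatest; x≤x∨y; y≤x∨y)
    renaming (refl to ≤-refl; trans to ≤-trans; reflexive to ≤-reflexive)
  open MeetSemilatticeProperties (OrderTheoretic.Lattice.meetSemilattice ∨-∧-orderTheoreticLattice)
    public using (∧-monotonic)
  open JoinSemilatticeProperties (OrderTheoretic.Lattice.joinSemilattice ∨-∧-orderTheoreticLattice)
    public using (∨-monotonic; x≤y⇒x∨y≈y)

  ≤⇒≤B : ∀ {x y} → x ≤ y → _≤B_ X x y
  ≤⇒≤B = sym

  x≤⊤ : ∀ x → x ≤ ⊤
  x≤⊤ x = sym (∧-identityʳ x)

  ⊥≤x : ∀ x → ⊥ ≤ x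
  ⊥≤x x = sym (∧-zeroˡ x)

  x≤⊥⇒x≈⊥ : ∀ {x} → x ≤ ⊥ → x ≈ ⊥
  x≤⊥⇒x≈⊥ {x} x≤⊥ = trans x≤⊥ (∧-zeroʳ x)

  ¬-antitone : ∀ {x y} → x ≤ y → ¬ y ≤ ¬ x
  ¬-antitone {x} {y} x≤y = begin
    ¬ y         ≈⟨ X.¬-cong (x≤y⇒x∨y≈y x≤y) ⟨
    ¬ (x ∨ y)   ≈⟨ deMorgan₂ x y ⟩
    ¬ x ∧ ¬ y   ≈⟨ X.∧-comm (¬ x) (¬ y) ⟩
    ¬ y ∧ ¬ x   ∎

  x∧¬y≈⊥⇒x≤y : ∀ {x y} → x ∧ ¬ y ≈ ⊥ → x ≤ y
  x∧¬y≈⊥⇒x≤y {x} {y} x∧¬y≈⊥ = begin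
    x                  ≈⟨ ∧-identityʳ x ⟨
    x ∧ ⊤              ≈⟨ ∧-congˡ (∨-complementʳ y) ⟨
    x ∧ (y ∨ ¬ y)      ≈⟨ ∧-distribˡ-∨ x y (¬ y) ⟩
    x ∧ y ∨ x ∧ ¬ y    ≈⟨ ∨-congˡ x∧¬y≈⊥ ⟩
    x ∧ y ∨ ⊥          ≈⟨ ∨-identityʳ (x ∧ y) ⟩
    x ∧ y              ∎

  ¬x∧[x∨y]≤y : ∀ x y → ¬ x ∧ (x ∨ y) ≤ y
  ¬x∧[x∨y]≤y x y = ≤-trans (≤-reflexive ¬x∧[x∨y]≈¬x∧y) (x∧y≤y (¬ x) y)
    where
    ¬x∧[x∨y]≈¬x∧y : ¬ x ∧ (x ∨ y) ≈ ¬ x ∧ y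
    ¬x∧[x∨y]≈¬x∧y = begin
      ¬ x ∧ (x ∨ y)          ≈⟨ ∧-distribˡ-∨ (¬ x) x y ⟩
      ¬ x ∧ x ∨ ¬ x ∧ y      ≈⟨ ∨-congʳ (∧-complementˡ x) ⟩
      ⊥ ∨ ¬ x ∧ y            ≈⟨ ∨-identityˡ (¬ x ∧ y) ⟩
      ¬ x ∧ y                ∎

  x≈y⇒x∧¬y∨¬x∧y≈⊥ : ∀ {x y} → x ≈ y → x ∧ ¬ y ∨ ¬ x ∧ y ≈ ⊥
  x≈y⇒x∧¬y∨¬x∧y≈⊥ {x} {y} x≈y = begin
    x ∧ ¬ y ∨ ¬ x ∧ y    ≈⟨ X.∨-cong (∧-congʳ x≈y) (∧-congʳ (X.¬-cong x≈y)) ⟩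
    y ∧ ¬ y ∨ ¬ y ∧ y    ≈⟨ X.∨-cong (∧-complementʳ y) (∧-complementˡ y) ⟩
    ⊥ ∨ ⊥                ≈⟨ ∨-identityʳ ⊥ ⟩
    ⊥                    ∎

U-isSubalgebra : ∀ {c ℓ} (X : BooleanAlgebra c ℓ) → IsSubalgebra X RU.U
U-isSubalgebra X = record
  { resp = λ _ _ → tt ; ⊤∈ = tt ; ⊥∈ = tt ; ∧∈ = λ _ _ → tt ; ∨∈ = λ _ _ → tt ; ¬∈ = λ _ → tt }

module Ultrafilter {c ℓ a u : Level} {X : BooleanAlgebra c ℓ}
                   {A : Pred (BooleanAlgebra.Carrier X) a} {U : Pred (BooleanAlgebra.Carrier X) u}
                   (S : IsSubalgebra X A) (F : IsUltrafilter X A U) where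
  open BooleanAlgebra X
  open BooleanOrder X
  private module S = IsSubalgebra S
  open IsUltrafilter F public

  up≤ : ∀ {x y} → U x → A y → x ≤ y → U y
  up≤ ux ay x≤y = up ux ay (≤⇒≤B x≤y)

  resp : ∀ {x y} → x ≈ y → U x → U y
  resp x≈y ux = up≤ ux (S.resp x≈y (sub ux)) (≤-reflexive x≈y)

  x∈⇒¬x∉ : ∀ {x} → U x → Not (U (¬ x))
  x∈⇒¬x∉ {x} ux u¬x = ⊥∉ (resp (∧-complementʳ x) (∧∈ ux u¬x))

  ∧-⇔ : ∀ {x y} → A x → A y → U (x ∧ y) ⇔ (U x × U y)
  ∧-⇔ {x} {y} ax ay = mk⇔
    (λ uxy → up≤ uxy ax (x∧y≤x x y) , up≤ uxy ay (x∧y≤y x y))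
    (λ (ux , uy) → ∧∈ ux uy)

  ∨-⇔ : ∀ {x y} → A x → A y → U (x ∨ y) ⇔ (U x ⊎ U y)
  ∨-⇔ {x} {y} ax ay = mk⇔ to from
    where
    to : U (x ∨ y) → U x ⊎ U y
    to uxy with ultra ax
    ... | inj₁ ux  = inj₁ ux
    ... | inj₂ u¬x = inj₂ (up≤ (∧∈ u¬x uxy) ay (¬x∧[x∨y]≤y x y))
    from : U x ⊎ U y → U (x ∨ y)
    from (inj₁ ux) = up≤ ux (S.∨∈ ax ay) (x≤x∨y x y)
    from (inj₂ uy) = up≤ uy (S.∨∈ ax ay) (y≤x∨y x y)

  ¬-⇔ : ∀ {x} → A x → U (¬ x) ⇔ Not (U x)
  ¬-⇔ {x} ax = mk⇔ (λ u¬x ux → x∈⇒¬x∉ ux u¬x) from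
    where
    from : Not (U x) → U (¬ x)
    from ∉ with ultra ax
    ... | inj₁ ux  = ⊥-elim (∉ ux)
    ... | inj₂ u¬x = u¬x

ultrafilter-⊆⇒⇔ : ∀ {c ℓ a a′ u v} {X : BooleanAlgebra c ℓ} {A : Pred (BooleanAlgebra.Carrier X) a}
  {A′ : Pred (BooleanAlgebra.Carrier X) a′} {U : Pred (BooleanAlgebra.Carrier X) u}
  {V : Pred (BooleanAlgebra.Carrier X) v} → IsSubalgebra X A → IsUltrafilter X A U →
  IsSubalgebra X A′ → IsUltrafilter X A′ V → U ⊆ V → ∀ {x} → A x → U x ⇔ V x
ultrafilter-⊆⇒⇔ {U = U} {V = V} S F S′ G U⊆V {x} ax = mk⇔ U⊆V from
  where
  from : V x → U x
  from vx with IsUltrafilter.ultra F ax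
  ... | inj₁ ux  = ux
  ... | inj₂ u¬x = ⊥-elim (Ultrafilter.x∈⇒¬x∉ S′ G vx (U⊆V u¬x))

module _ {c ℓ : Level} (X : BooleanAlgebra c ℓ) where
  open BooleanAlgebra X
  open BooleanOrder X

  upClosure : ∀ {i} {I : Set i} → (I → Carrier) → Pred Carrier (i ⊔ ℓ)
  upClosure {I = I} b x = Σ I λ k → b k ≤ x

  upClosure-isProperFilter : ∀ {i} {I : Set i} {b : I → Carrier} → I →
    (∀ k k′ → Σ I λ m → b m ≤ b k ∧ b k′) → (∀ k → Not (b k ≈ ⊥)) →
    IsProperFilter X (upClosure b)
  upClosure-isProperFilter {b = b} k₀ directed nonzero = record
    { ⊤∈ = k₀ , x≤⊤ (b k₀)
    ; ⊥∉ = λ (k , bk≤⊥) → nonzero k (x≤⊥⇒x≈⊥ bk≤⊥)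
    ; ∧∈ = λ (k , bk≤x) (k′ , bk′≤y) →
             let m , bm≤ = directed k k′ in m , ≤-trans bm≤ (∧-monotonic bk≤x bk′≤y)
    ; up = λ (k , bk≤x) x∧y≈x → k , ≤-trans bk≤x (sym x∧y≈x)
    }

-- Excluded middle makes every predicate equivalent to one of any chosen level,
-- so BPI at level u extends proper filters of arbitrary level.
extendToUltrafilter : ∀ {c ℓ f u} → ExcludedMiddle f → BPI c ℓ u →
  (X : BooleanAlgebra c ℓ) {F : Pred (BooleanAlgebra.Carrier X) f} → IsProperFilter X F →
  Σ (Pred (BooleanAlgebra.Carrier X) u) λ V → IsUltrafilter X RU.U V × F ⊆ V
extendToUltrafilter {u = u} em bpi X {F} F-proper =
  let V , V-ultra , F′⊆V = bpi X F′ F′-proper in V , V-ultra , λ Fx → F′⊆V (toF′ Fx)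
  where
  module F = IsProperFilter F-proper
  F′ : Pred (BooleanAlgebra.Carrier X) u
  F′ x = Lift u (True (em {F x}))
  toF′ : F ⊆ F′
  toF′ Fx = lift (fromWitness Fx)
  fromF′ : F′ ⊆ F
  fromF′ F′x = toWitness (lower F′x)
  F′-proper : IsProperFilter X F′
  F′-proper = record
    { ⊤∈ = toF′ F.⊤∈
    ; ⊥∉ = λ F′⊥ → F.⊥∉ (fromF′ F′⊥)
    ; ∧∈ = λ F′x F′y → toF′ (F.∧∈ (fromF′ F′x) (fromF′ F′y))
    ; up = λ F′x x≤y → toF′ (F.up (fromF′ F′x) x≤y)
    }

module FreeProduct {c ℓ p : Level} (B : BooleanAlgebra c ℓ) (n : ℕ)
                   (A : Fin n → Pred (BooleanAlgebra.Carrier B) p) where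

  freeProduct : BooleanAlgebra (c ⊔ p) (c ⊔ ℓ ⊔ p)
  freeProduct = record
    { Carrier = Tm B n A ; _≈_ = _≈F_ B n A ; _∨_ = _∨ᵗ_ ; _∧_ = _∧ᵗ_ ; ¬_ = ¬ᵗ_ ; ⊤ = ⊤ᵗ ; ⊥ = ⊥ᵗ
    ; isBooleanAlgebra = record
      { isDistributiveLattice = record
        { isLattice = record
          { isEquivalence = record { refl = reflF ; sym = symF ; trans = transF }
          ; ∨-comm = ∨-comm ; ∨-assoc = ∨-assoc ; ∨-cong = ∨-cong
          ; ∧-comm = ∧-comm ; ∧-assoc = ∧-assoc ; ∧-cong = ∧-cong
          ; absorptive = ∨-absorbs-∧ , ∧-absorbs-∨ }
        ; ∨-distrib-∧ = ∨-distrib-∧ , λ s t u →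
            transF (∨-comm _ _) (transF (∨-distrib-∧ s t u) (∧-cong (∨-comm s t) (∨-comm s u)))
        ; ∧-distrib-∨ = ∧-distrib-∨ , λ s t u →
            transF (∧-comm _ _) (transF (∧-distrib-∨ s t u) (∨-cong (∧-comm s t) (∧-comm s u)))
        }
      ; ∨-complement = (λ s → transF (∨-comm _ _) (∨-complement s)) , ∨-complement
      ; ∧-complement = (λ s → transF (∧-comm _ _) (∧-complement s)) , ∧-complement
      ; ¬-cong = ¬-cong
      }
    }

  open BooleanOrder freeProduct

  ⋁-++ˡ : ∀ gs gs′ → ⋁ B n A gs ≤ ⋁ B n A (gs ++ gs′)
  ⋁-++ˡ []       gs′ = ⊥≤x _
  ⋁-++ˡ (g ∷ gs) gs′ = ∨-monotonic (≤-refl {genTm B n A g}) (⋁-++ˡ gs gs′)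

  ⋁-++ʳ : ∀ gs gs′ → ⋁ B n A gs′ ≤ ⋁ B n A (gs ++ gs′)
  ⋁-++ʳ []       gs′ = ≤-refl
  ⋁-++ʳ (g ∷ gs) gs′ = ≤-trans (⋁-++ʳ gs gs′) (y≤x∨y (genTm B n A g) _)

module Character {c ℓ p : Level} (em : ∀ {a} → ExcludedMiddle a)
                 {B : BooleanAlgebra c ℓ} {n : ℕ} {A : Fin n → Pred (BooleanAlgebra.Carrier B) p}
                 (SA : ∀ i → IsSubalgebra B (A i))
                 {U : Fin n → Pred (BooleanAlgebra.Carrier B) p}
                 (UF : ∀ i → IsUltrafilter B (A i) (U i))
                 (compatible : ∀ i j x → (U i x × A j x) ⇔ (U j x × A i x)) where
  open BooleanAlgebra B using (_≈_) renaming (sym to ≈-sym)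
  module Ui (i : Fin n) = Ultrafilter (SA i) (UF i)

  χ : Tm B n A → Bool
  χ (ι i a _) = does (em {_} {U i a})
  χ (s ∨ᵗ t)  = χ s || χ t
  χ (s ∧ᵗ t)  = χ s && χ t
  χ (¬ᵗ s)    = not (χ s)
  χ ⊤ᵗ        = true
  χ ⊥ᵗ        = false

  χ-resp : ∀ {s t} → _≈F_ B n A s t → χ s ≡ χ t
  χ-resp reflF                     = refl
  χ-resp (symF e)                  = ≡.sym (χ-resp e)
  χ-resp (transF e e′)             = ≡.trans (χ-resp e) (χ-resp e′)
  χ-resp (∨-cong e e′)             = cong₂ _||_ (χ-resp e) (χ-resp e′)
  χ-resp (∧-cong e e′)             = cong₂ _&&_ (χ-resp e) (χ-resp e′)
  χ-resp (¬-cong e)                = cong not (χ-resp e)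
  χ-resp (∨-comm s t)              = Bool.∨-comm (χ s) (χ t)
  χ-resp (∧-comm s t)              = Bool.∧-comm (χ s) (χ t)
  χ-resp (∨-assoc s t u)           = Bool.∨-assoc (χ s) (χ t) (χ u)
  χ-resp (∧-assoc s t u)           = Bool.∧-assoc (χ s) (χ t) (χ u)
  χ-resp (∨-absorbs-∧ s t)         = Bool.∨-abs-∧ (χ s) (χ t)
  χ-resp (∧-absorbs-∨ s t)         = Bool.∧-abs-∨ (χ s) (χ t)
  χ-resp (∨-distrib-∧ s t u)       = Bool.∨-distribˡ-∧ (χ s) (χ t) (χ u)
  χ-resp (∧-distrib-∨ s t u)       = Bool.∧-distribˡ-∨ (χ s) (χ t) (χ u)
  χ-resp (∨-complement s)          = Bool.∨-inverseʳ (χ s)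
  χ-resp (∧-complement s)          = Bool.∧-inverseʳ (χ s)
  χ-resp (ι-cong i _ _ a≈b)        = does-⇔ (mk⇔ (Ui.resp i a≈b) (Ui.resp i (≈-sym a≈b))) em em
  χ-resp (ι-∨ i pa pb _)           = does-⇔ (Ui.∨-⇔ i pa pb) em (em ⊎-dec em)
  χ-resp (ι-∧ i pa pb _)           = does-⇔ (Ui.∧-⇔ i pa pb) em (em ×-dec em)
  χ-resp (ι-¬ i pa _)              = does-⇔ (Ui.¬-⇔ i pa) em (¬? em)
  χ-resp (ι-⊤ i _)                 = dec-true em (Ui.⊤∈ i)
  χ-resp (ι-⊥ i _)                 = dec-false em (Ui.⊥∉ i)

  χ-genTm : ∀ g → χ (genTm B n A g) ≡ false
  χ-genTm (idealGen i j z zi zj nzj) = dec-false (em ×-dec em) λ (uiz , uj¬z) →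
    Ui.x∈⇒¬x∉ j (proj₁ (Equivalence.to (compatible i j z) (uiz , zj))) uj¬z

  χ-⋁ : ∀ gs → χ (⋁ B n A gs) ≡ false
  χ-⋁ []       = refl
  χ-⋁ (g ∷ gs) = cong₂ _||_ (χ-genTm g) (χ-⋁ gs)

  χ-InIdeal : ∀ {s} → InIdeal B n A s → χ s ≡ false
  χ-InIdeal {s} (gs , s≤⋁gs) = begin
    χ s                   ≡⟨ χ-resp s≤⋁gs ⟨
    χ s && χ (⋁ B n A gs) ≡⟨ cong (χ s &&_) (χ-⋁ gs) ⟩
    χ s && false          ≡⟨ Bool.∧-zeroʳ (χ s) ⟩
    false                 ∎
    where open ≡-Reasoning

  χ-Δ⊥ᵗ : ∀ s → χ (_Δ_ B n A s ⊥ᵗ) ≡ χ s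
  χ-Δ⊥ᵗ s with χ s
  ... | true  = refl
  ... | false = refl

  χ⁻¹true : Set (c ⊔ p)
  χ⁻¹true = Σ (Tm B n A) λ s → χ s ≡ true

  evalχ⁻¹true : χ⁻¹true → BooleanAlgebra.Carrier B
  evalχ⁻¹true (s , _) = eval B n A s

  eval-χ⁻¹true≉⊥ : Commutes B n A → ∀ k → Not (evalχ⁻¹true k ≈ BooleanAlgebra.⊥ B)
  eval-χ⁻¹true≉⊥ commutes (s , χs) s≈⊥ = true≢false (begin
    true                 ≡⟨ χs ⟨
    χ s                  ≡⟨ χ-Δ⊥ᵗ s ⟨
    χ (_Δ_ B n A s ⊥ᵗ)   ≡⟨ χ-InIdeal (commutes s ⊥ᵗ s≈⊥) ⟩
    false                ∎)
    where
    open ≡-Reasoning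
    true≢false : Not (true ≡ false)
    true≢false ()

  image-isProperFilter : Commutes B n A → IsProperFilter B (upClosure B evalχ⁻¹true)
  image-isProperFilter commutes = upClosure-isProperFilter B (⊤ᵗ , refl)
    (λ (s , χs) (t , χt) → (s ∧ᵗ t , cong₂ _&&_ χs χt) , BooleanOrder.≤-refl B)
    (eval-χ⁻¹true≉⊥ commutes)

commutes⇒ultrafilterExtension : (∀ {a} → ExcludedMiddle a) → (∀ {c ℓ u} → BPI c ℓ u) →
  ∀ {c ℓ p} {B : BooleanAlgebra c ℓ} {n : ℕ} {A : Fin n → Pred (BooleanAlgebra.Carrier B) p} →
  (∀ i → IsSubalgebra B (A i)) → Commutes B n A → UltrafilterExtension B n A
commutes⇒ultrafilterExtension em bpi {p = p} {B = B} SA commutes U UF compatible =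
  let V , V-ultra , F⊆V = extendToUltrafilter {u = p} em bpi B (image-isProperFilter commutes)
  in V , V-ultra , λ i Uix →
       F⊆V ((ι i _ (IsUltrafilter.sub (UF i) Uix) , dec-true em Uix) , BooleanOrder.≤-refl B)
  where open Character em SA UF compatible

idealAvoidingUltrafilter : (∀ {a} → ExcludedMiddle a) → (∀ {c ℓ u} → BPI c ℓ u) →
  ∀ {c ℓ p} (B : BooleanAlgebra c ℓ) (n : ℕ) (A : Fin n → Pred (BooleanAlgebra.Carrier B) p) →
  ∀ {d} → Not (InIdeal B n A d) →
  Σ (Pred (Tm B n A) p) λ W → IsUltrafilter (FreeProduct.freeProduct B n A) RU.U W ×
    W d × (∀ g → Not (W (genTm B n A g)))
idealAvoidingUltrafilter em bpi {p = p} B n A {d} d∉ =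
  let W , W-ultra , G⊆W = extendToUltrafilter {u = p} em bpi freeProduct G-isProperFilter
  in W , W-ultra , G⊆W ([] , x∧y≤x d _) ,
     λ g Wg → Ultrafilter.x∈⇒¬x∉ (U-isSubalgebra freeProduct) W-ultra Wg
                (G⊆W ((g ∷ []) , avoid[g]≤¬g g))
  where
  open FreeProduct B n A
  open BooleanOrder freeProduct

  avoid : List (IdealGen B n A) → Tm B n A
  avoid gs = d ∧ᵗ (¬ᵗ ⋁ B n A gs)

  avoid-directed : ∀ gs gs′ → avoid (gs ++ gs′) ≤ (avoid gs ∧ᵗ avoid gs′)
  avoid-directed gs gs′ = ∧-greatest
    (∧-monotonic (≤-refl {d}) (¬-antitone (⋁-++ˡ gs gs′)))
    (∧-monotonic (≤-refl {d}) (¬-antitone (⋁-++ʳ gs gs′)))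

  avoid[g]≤¬g : ∀ g → avoid (g ∷ []) ≤ (¬ᵗ genTm B n A g)
  avoid[g]≤¬g g = ≤-trans (x∧y≤y d _) (¬-antitone (x≤x∨y (genTm B n A g) ⊥ᵗ))

  G-isProperFilter : IsProperFilter freeProduct (upClosure freeProduct avoid)
  G-isProperFilter = upClosure-isProperFilter freeProduct []
    (λ gs gs′ → gs ++ gs′ , avoid-directed gs gs′)
    (λ gs avoid≈⊥ → d∉ (gs , ≤⇒≤B (x∧¬y≈⊥⇒x≤y avoid≈⊥)))

module Preimage {c ℓ p : Level} {B : BooleanAlgebra c ℓ} {n : ℕ}
                {A : Fin n → Pred (BooleanAlgebra.Carrier B) p}
                (SA : ∀ i → IsSubalgebra B (A i)) {W : Pred (Tm B n A) p}
                (W-ultra : IsUltrafilter (FreeProduct.freeProduct B n A) RU.U W)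
                (genTm∉W : ∀ g → Not (W (genTm B n A g))) where
  open BooleanAlgebra B using (Carrier; ¬_; sym) renaming (refl to ≈-refl)
  open FreeProduct B n A using (freeProduct)
  module W = Ultrafilter (U-isSubalgebra freeProduct) W-ultra
  module SA (i : Fin n) = IsSubalgebra (SA i)

  U : Fin n → Pred Carrier p
  U i a = Σ (A i a) λ pa → W (ι i a pa)

  W-ι⇔U : ∀ i {a} (pa : A i a) → W (ι i a pa) ⇔ U i a
  W-ι⇔U i pa = mk⇔ (pa ,_) λ (pa′ , w) → W.resp (ι-cong i pa′ pa ≈-refl) w

  W-ι¬ : ∀ i {a} (pa : A i a) → W (¬ᵗ ι i a pa) → U i (¬ a)
  W-ι¬ i pa w = SA.¬∈ i pa , W.resp (symF (ι-¬ i pa _)) w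

  U-isUltrafilter : ∀ i → IsUltrafilter B (A i) (U i)
  U-isUltrafilter i = record
    { sub   = proj₁
    ; ⊤∈    = SA.⊤∈ i , W.resp (symF (ι-⊤ i _)) W.⊤∈
    ; ⊥∉    = λ (pa , w) → W.⊥∉ (W.resp (ι-⊥ i pa) w)
    ; ∧∈    = λ (pa , wa) (pb , wb) → SA.∧∈ i pa pb , W.resp (symF (ι-∧ i pa pb _)) (W.∧∈ wa wb)
    ; up    = λ (px , wx) py x∧y≈x → py ,
                W.up wx tt (symF (transF (ι-cong i px (SA.∧∈ i px py) (sym x∧y≈x)) (ι-∧ i px py _)))
    ; ultra = λ px → Sum.map (px ,_) (W-ι¬ i px) (W.ultra tt)
    }

  -- Otherwise the ideal generator ι_i(x) ∧ ι_j(¬ x) would lie in W.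
  U-transfer : ∀ i j {x} → U i x → A j x → U j x
  U-transfer i j {x} (pa , w) ajx with W.ultra {ι j x ajx} tt
  ... | inj₁ w′  = ajx , w′
  ... | inj₂ w¬′ = ⊥-elim (genTm∉W (idealGen i j x pa ajx (SA.¬∈ j ajx))
                                    (W.∧∈ w (proj₂ (W-ι¬ j ajx w¬′))))

  U-compatible : ∀ i j x → (U i x × A j x) ⇔ (U j x × A i x)
  U-compatible i j x = mk⇔ (λ (u , ajx) → U-transfer i j u ajx , proj₁ u)
                           (λ (u , aix) → U-transfer j i u aix , proj₁ u)

  W⇔V∘eval : ∀ {v} {V : Pred Carrier v} → IsUltrafilter B RU.U V → (∀ i {x} → U i x → V x) →
             ∀ s → W s ⇔ V (eval B n A s)
  W⇔V∘eval {V = V} V-ultra U⊆V = go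
    where
    module V = Ultrafilter (U-isSubalgebra B) V-ultra
    go : ∀ s → W s ⇔ V (eval B n A s)
    go (ι i a pa) = ultrafilter-⊆⇒⇔ (SA i) (U-isUltrafilter i) (U-isSubalgebra B) V-ultra (U⊆V i) pa
                      ⇔-∘ W-ι⇔U i pa
    go (s ∨ᵗ t)   = ⇔-sym (V.∨-⇔ tt tt) ⇔-∘ ((go s ⊎-⇔ go t) ⇔-∘ W.∨-⇔ tt tt)
    go (s ∧ᵗ t)   = ⇔-sym (V.∧-⇔ tt tt) ⇔-∘ ((go s ×-⇔ go t) ⇔-∘ W.∧-⇔ tt tt)
    go (¬ᵗ s)     = ⇔-sym (V.¬-⇔ tt) ⇔-∘ (¬-cong-⇔ (go s) ⇔-∘ W.¬-⇔ tt)
    go ⊤ᵗ         = mk⇔ (λ _ → V.⊤∈) (λ _ → W.⊤∈)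
    go ⊥ᵗ         = mk⇔ (λ w → ⊥-elim (W.⊥∉ w)) (λ v → ⊥-elim (V.⊥∉ v))

ultrafilterExtension⇒commutes : (∀ {a} → ExcludedMiddle a) → (∀ {c ℓ u} → BPI c ℓ u) →
  ∀ {c ℓ p} {B : BooleanAlgebra c ℓ} {n : ℕ} {A : Fin n → Pred (BooleanAlgebra.Carrier B) p} →
  (∀ i → IsSubalgebra B (A i)) → UltrafilterExtension B n A → Commutes B n A
ultrafilterExtension⇒commutes em bpi {B = B} {n} {A} SA extension s t s≈t
  with em {_} {InIdeal B n A (_Δ_ B n A s t)}
... | yes Δ∈ = Δ∈
... | no Δ∉ =
  let W , W-ultra , W-Δ , genTm∉W = idealAvoidingUltrafilter em bpi B n A Δ∉
      open Preimage SA W-ultra genTm∉W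
      V , V-ultra , U⊆V = extension U U-isUltrafilter U-compatible
  in ⊥-elim (IsUltrafilter.⊥∉ V-ultra
       (Ultrafilter.resp (U-isSubalgebra B) V-ultra (BooleanOrder.x≈y⇒x∧¬y∨¬x∧y≈⊥ B s≈t)
         (Equivalence.to (W⇔V∘eval V-ultra U⊆V (_Δ_ B n A s t)) W-Δ)))

lemma3p33 : (∀ {a} → ExcludedMiddle a) → (∀ {c ℓ u} → BPI c ℓ u) →
    ∀ {c ℓ p} (B : BooleanAlgebra c ℓ) (n : ℕ)
      (A : Fin n → Pred (BooleanAlgebra.Carrier B) p) →
      (∀ i → IsSubalgebra B (A i)) →
      Commutes B n A ⇔ UltrafilterExtension B n A
lemma3p33 em bpi B n A SA =
  mk⇔ (commutes⇒ultrafilterExtension em bpi SA) (ultrafilterExtension⇒commutes em bpi SA)
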